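{- Let $\mathcal K=\mathcal{OPO}$, the class of finite partial orders with a linear extension. Then for each $\mathbf H\in\mathcal K$ there is a structure $\overline{\mathbf H}\in\mathcal K$ containing a copy of $\mathbf H$ with the following property: for every universal inverse limit structure $\mathbf G$ for $\mathcal K$ contained in $\mathbf{F_{\max}}$ and every copy $\overline{\mathbf I}$ of $\overline{\mathbf H}$ in $\mathbf G$, the induced subtree $T_{\overline{\mathbf I}}$ of $T_{\mathbf G}$ has exactly one splitting node $t=\mathrm{stem}(T_{\overline{\mathbf I}})$; consequently the immediate successors of $\mathrm{stem}(T_{\overline{\mathbf I}})$ in $T_{\overline{\mathbf I}}$ carry a copy of $\overline{\mathbf I}$ (i.e. the induced substructure of $\mathbf{F_t}$ on $\mathrm{succ}_{T_{\overline{\mathbf I}}}(t)$ is isomorphic to $\overline{\mathbf I}$).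
   Context: $\mathcal{OPO}$ consists of finite structures $\langle P,<,R\rangle$ with $R$ a partial order on $P$, $<$ a linear order on $P$, and $x\ne y$, $R(x,y)$ implying $x<y$; it is a Fra\"{\i}ss\'{e} class with Fra\"{\i}ss\'{e} limit taken on $\omega$, and $\mathrm{Flim}(\mathcal K)_n$ is its restriction to $\{0,\dots,n\}$. Copies are induced substructures isomorphic to the given one. Trees: $\omega^{<\omega}$ with initial segment order; $|s|$; $\mathrm{succ}_T(t)$; $[T]$ branches; $x\cap y$ longest common initial segment of distinct branches; a splitting node has more than one immediate successor; $\mathrm{stem}(T)$ is the minimal splitting node. $T_{\max}$: $\mathrm{succ}_{T_{\max}}(t)=\{t^\frown\langle0\rangle,\dots,t^\frown\langle|t|\rangle\}$; fixed $\mathbf{F_t}\in\mathcal K$ on $\mathrm{succ}_{T_{\max}}(t)$ (lexicographic order) isomorphic to $\mathrm{Flim}(\mathcal K)_{|t|}$; $\mathbf{F_{\max}}$ on $[T_{\max}]$ ordered lexicographically with $(x,y)\in R$ (distinct $x,y$) iff $(x\upharpoonright(|x\cap y|+1),y\upharpoonright(|x\cap y|+1))\in R^{\mathbf{F_{x\cap y}}}$. For $\mathbf G\le\mathbf{F_{\max}}$, $T_{\mathbf G}=\{x\upharpoonright n:x\in G,n\in\omega\}$. A universal inverse limit structure for $\mathcal K$ contained in $\mathbf{F_{\max}}$ is an induced substructure $\mathbf G$ of $\mathbf{F_{\max}}$ whose universe is a closed subset of $[T_{\max}]\subseteq\omega^\omega$ without isolated points such that every nonempty open interval of $G$ contains induced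 copies of all structures in $\mathcal K$. -}

module Defs where

open import Data.Nat using (ℕ; zero; suc; _≤_; _<_)
open import Data.Fin as Fin using (Fin; toℕ)
open import Data.List using (List; []; _∷_; applyUpTo; length; _∷ʳ_)
open import Data.Maybe using (Maybe; just; nothing)
open import Data.Product using (Σ; _×_; _,_)
open import Data.Sum using (_⊎_)
open import Data.Unit using (⊤)
open import Relation.Nullary using (¬_)
open import Relation.Binary.PropositionalEquality using (_≡_; _≢_)

_⟺_ : Set → Set → Set
P ⟺ Q = (P → Q) × (Q → P)

record Str (A : Set) : Set₁ where
  field
    lt : A → A → Set
    R  : A → A → Set
open Str public

record IsOPO {A : Set} (S : Str A) : Set where
  field
    lt-irrefl : ∀ x → ¬ lt S x x
    lt-trans  : ∀ {x y z} → lt S x y → lt S y z → lt S x z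
    lt-total  : ∀ x y → x ≢ y → lt S x y ⊎ lt S y x
    R-refl    : ∀ x → R S x x
    R-antisym : ∀ {x y} → R S x y → R S y x → x ≡ y
    R-trans   : ∀ {x y z} → R S x y → R S y z → R S x z
    R⊆lt      : ∀ {x y} → R S x y → x ≢ y → lt S x y

record FinOPO : Set₁ where
  field
    size  : ℕ
    str   : Str (Fin size)
    isOPO : IsOPO str
open FinOPO public

record Embedding {A B : Set} (S : Str A) (T : Str B) : Set where
  field
    map       : A → B
    injective : ∀ {x y} → map x ≡ map y → x ≡ y
    lt-pres   : ∀ x y → lt S x y ⟺ lt T (map x) (map y)
    R-pres    : ∀ x y → R S x y ⟺ R T (map x) (map y)
open Embedding public

record Iso {A B : Set} (S : Str A) (T : Str B) : Set where
  field
    emb        : Embedding S T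
    surjective : ∀ y → Σ A (λ x → map emb x ≡ y)
open Iso public

record IsFraisseLimit (L : Str ℕ) : Set₁ where
  field
    isOPO     : IsOPO L
    universal : (A : FinOPO) → Embedding (str A) L
    ultrahom  : (A : FinOPO) (e₁ e₂ : Embedding (str A) L) →
                Σ (Iso L L) (λ σ → ∀ i → map (emb σ) (map e₁ i) ≡ map e₂ i)

_↾_ : Str ℕ → (n : ℕ) → Str (Fin (suc n))
lt (L ↾ n) i j = lt L (toℕ i) (toℕ j)
R  (L ↾ n) i j = R L (toℕ i) (toℕ j)

Branch : Set
Branch = ℕ → ℕ

prefix : Branch → ℕ → List ℕ
prefix x n = applyUpTo x n

InTmax : Branch → Set
InTmax x = ∀ n → x n ≤ n

nodeFrom : ℕ → List ℕ → Set
nodeFrom k []      = ⊤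
nodeFrom k (a ∷ t) = (a ≤ k) × nodeFrom (suc k) t

TmaxNode : List ℕ → Set
TmaxNode = nodeFrom 0

_≈_ : Branch → Branch → Set
x ≈ y = ∀ n → x n ≡ y n

Agree : ℕ → Branch → Branch → Set
Agree n x y = ∀ k → k < n → x k ≡ y k

_<lex_ : Branch → Branch → Set
x <lex y = Σ ℕ (λ n → Agree n x y × x n < y n)

-- The fixed structures F_t are given by relations FR t on indices:
-- R^{F_t}(t⌢⟨i⟩, t⌢⟨j⟩) iff FR t i j ; the order on succ(t) is lexicographic,
-- i.e. by the last coordinate.
Fstr : (List ℕ → ℕ → ℕ → Set) → (t : List ℕ) → Str (Fin (suc (length t)))
lt (Fstr FR t) i j = i Fin.< j
R  (Fstr FR t) i j = FR t (toℕ i) (toℕ j)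

-- R on F_max: reflexive, and for distinct x,y (first difference at
-- n = |x ∩ y|), R(x,y) iff R^{F_{x∩y}}(x↾(n+1), y↾(n+1)).
FmaxR : (List ℕ → ℕ → ℕ → Set) → Branch → Branch → Set
FmaxR FR x y = (x ≈ y) ⊎
  Σ ℕ (λ n → Agree n x y × (x n ≢ y n) × FR (prefix x n) (x n) (y n))

record Copy (FR : List ℕ → ℕ → ℕ → Set) (P : Branch → Set) {k : ℕ}
            (S : Str (Fin k)) : Set where
  field
    elt     : Fin k → Branch
    inP     : ∀ i → P (elt i)
    inj     : ∀ i j → elt i ≈ elt j → i ≡ j
    lt-pres : ∀ i j → lt S i j ⟺ (elt i <lex elt j)
    R-pres  : ∀ i j → R S i j ⟺ FmaxR FR (elt i) (elt j)
open Copy public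

-- open intervals of (G, <lex), possibly unbounded on either side
EndIn : (Branch → Set) → Maybe Branch → Set
EndIn G nothing  = ⊤
EndIn G (just a) = G a

Above : Maybe Branch → Branch → Set
Above nothing  x = ⊤
Above (just a) x = a <lex x

Below : Maybe Branch → Branch → Set
Below nothing  x = ⊤
Below (just b) x = x <lex b

Interval : (Branch → Set) → Maybe Branch → Maybe Branch → Branch → Set
Interval G a b x = G x × Above a x × Below b x

record IsUILS (FR : List ℕ → ℕ → ℕ → Set) (G : Branch → Set) : Set₁ where
  field
    ⊆Tmax      : ∀ x → G x → InTmax x
    closed     : ∀ x → (∀ n → Σ Branch (λ y → G y × Agree n x y)) → G x
    noIsolated : ∀ x → G x →
                 ¬ Σ ℕ (λ n → ∀ y → G y → Agree n x y → x ≈ y)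
    universal  : (a b : Maybe Branch) → EndIn G a → EndIn G b →
                 Σ Branch (Interval G a b) →
                 (A : FinOPO) → Copy FR (Interval G a b) (str A)

InT : {k : ℕ} → (Fin k → Branch) → List ℕ → Set
InT {k} e s = Σ (Fin k) (λ i → Σ ℕ (λ n → s ≡ prefix (e i) n))

Splitting : {k : ℕ} → (Fin k → Branch) → List ℕ → Set
Splitting e s = Σ ℕ (λ a → Σ ℕ (λ b →
  (a ≢ b) × InT e (s ∷ʳ a) × InT e (s ∷ʳ b)))

-- The induced substructure of F_t on succ_{T_e}(t) is isomorphic to S
-- (f i is the last coordinate of the successor corresponding to i).
SuccIso : (FR : List ℕ → ℕ → ℕ → Set) {k : ℕ} (S : Str (Fin k)) →
          (Fin k → Branch) → (t : List ℕ) → Set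
SuccIso FR {k} S e t = Σ (Fin k → Fin (suc (length t))) (λ f →
    (∀ i → InT e (t ∷ʳ toℕ (f i)))
  × (∀ a → InT e (t ∷ʳ toℕ a) → Σ (Fin k) (λ i → f i ≡ a))
  × (∀ i j → f i ≡ f j → i ≡ j)
  × (∀ i j → lt S i j ⟺ (f i Fin.< f j))
  × (∀ i j → R S i j ⟺ FR t (toℕ (f i)) (toℕ (f j))))

-- T_I has exactly one splitting node t (hence t = stem(T_I)), and the
-- successors of t in T_I carry a copy of S.
OneSplit : (FR : List ℕ → ℕ → ℕ → Set) {k : ℕ} (S : Str (Fin k)) →
           (Fin k → Branch) → Set
OneSplit FR S e = Σ (List ℕ) (λ t →
  Splitting e t × (∀ s → Splitting e s → s ≡ t) × SuccIso FR S e t)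

-- Enlarge H to a prime structure Hb: one in which every set P of points that
-- each outside point sees uniformly (a module) is empty, a singleton or
-- everything.  In F_max the relations between two branches are read off at
-- the node where they split, so for a copy of Hb the points passing through any
-- fixed node form a module.  Hence every splitting node is passed by all points
-- of the copy, which leaves room for only one splitting node, and the copy is
-- realised on its immediate successors.
module Submission where

open import Defs
open import Data.Nat using (ℕ)
open import Data.List using (List; length)
open import Data.Product using (Σ; _×_)

open import Data.Empty using (⊥; ⊥-elim)
open import Data.Fin as Fin using (Fin; toℕ; fromℕ<; _↑ˡ_; _↑ʳ_; splitAt; join)
import Data.Fin.Properties as FinP
open import Data.List using (_∷ʳ_)
import Data.List.Properties as ListP
open import Data.Nat using (suc; zero; _≤_; _<_; _+_; s≤s)
import Data.Nat.Properties as ℕP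
open import Data.Product using (_,_; proj₁; proj₂)
import Data.Product as Product
open import Data.Sum using (_⊎_; inj₁; inj₂)
import Data.Sum as Sum
open import Data.Unit using (⊤; tt)
open import Function using (_∘_; id; _↔_; Inverse; Injection; mk↔ₛ′)
open import Function.Properties.Inverse using (↔⇒↣)
open import Relation.Binary.Construct.Closure.Reflexive as Refl using (ReflClosure; [_])
import Relation.Binary.Construct.Closure.Reflexive.Properties as ReflP
open import Relation.Nullary using (¬_; yes; no)
open import Relation.Binary.Definitions using (tri<; tri≈; tri>)
open import Relation.Unary using (Decidable)
open import Relation.Binary.PropositionalEquality
  using ( _≡_; _≢_; refl; sym; trans; cong; cong₂; subst; subst₂; ≢-sym
        ; module ≡-Reasoning)

⟺-trans : {P Q T : Set} → P ⟺ Q → Q ⟺ T → P ⟺ T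
⟺-trans (p→q , q→p) (q→t , t→q) = q→t ∘ p→q , q→p ∘ t→q

record LookAlikeFrom {A : Set} (S : Str A) (z w w′ : A) : Set where
  field
    lt-into  : lt S z w → lt S z w′
    lt-outof : lt S w z → lt S w′ z
    R-into   : R S z w → R S z w′
    R-outof  : R S w z → R S w′ z
open LookAlikeFrom

LookAlikeFrom-cong : {A : Set} {S : Str A} {z₁ z₂ w₁ w₂ w₁′ w₂′ : A} →
                     z₁ ≡ z₂ → w₁ ≡ w₂ → w₁′ ≡ w₂′ →
                     LookAlikeFrom S z₁ w₁ w₁′ → LookAlikeFrom S z₂ w₂ w₂′
LookAlikeFrom-cong refl refl refl = id

IsModule : {A : Set} → Str A → (A → Set) → Set
IsModule S P = ∀ {z w w′} → ¬ P z → P w → P w′ → LookAlikeFrom S z w w′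

IsPrime : {A : Set} → Str A → Set₁
IsPrime {A} S = (P : A → Set) → Decidable P → IsModule S P →
                ∀ {x y z} → P x → P y → x ≢ y → ¬ P z → ⊥

pullback : {A B : Set} → (B → A) → Str A → Str B
lt (pullback f S) i j = lt S (f i) (f j)
R  (pullback f S) i j = R S (f i) (f j)

pullback-isOPO : {A B : Set} {S : Str A} {f : B → A} →
                 (∀ {i j} → f i ≡ f j → i ≡ j) → IsOPO S → IsOPO (pullback f S)
pullback-isOPO {f = f} f-injective S-isOPO = record
  { lt-irrefl = λ i → lt-irrefl (f i)
  ; lt-trans  = lt-trans
  ; lt-total  = λ i j i≢j → lt-total (f i) (f j) (i≢j ∘ f-injective)
  ; R-refl    = λ i → R-refl (f i)
  ; R-antisym = λ r r′ → f-injective (R-antisym r r′)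
  ; R-trans   = R-trans
  ; R⊆lt      = λ r i≢j → R⊆lt r (i≢j ∘ f-injective)
  }
  where open IsOPO S-isOPO

Embedding-∘ : {A B C : Set} {S : Str A} {T : Str B} {U : Str C} →
              Embedding T U → Embedding S T → Embedding S U
Embedding-∘ g f = record
  { map       = map g ∘ map f
  ; injective = injective f ∘ injective g
  ; lt-pres   = λ x y → ⟺-trans (lt-pres f x y) (lt-pres g _ _)
  ; R-pres    = λ x y → ⟺-trans (R-pres f x y) (R-pres g _ _)
  }

Embedding-R-refl : {A B : Set} {S : Str A} {T : Str B} → Embedding S T →
                   (∀ y → R T y y) → ∀ x → R S x x
Embedding-R-refl f T-refl x = proj₂ (R-pres f x x) (T-refl (map f x))

module _ {A B : Set} (ι : B ↔ A) {S : Str A} where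
  open Inverse ι using (to; from; strictlyInverseˡ; strictlyInverseʳ)

  from-Embedding : Embedding S (pullback to S)
  from-Embedding = record
    { map       = from
    ; injective = λ {x} {y} eq →
        trans (sym (strictlyInverseˡ x)) (trans (cong to eq) (strictlyInverseˡ y))
    ; lt-pres   = λ x y → subst₂ (lt S) (sym (strictlyInverseˡ x)) (sym (strictlyInverseˡ y))
                        , subst₂ (lt S) (strictlyInverseˡ x) (strictlyInverseˡ y)
    ; R-pres    = λ x y → subst₂ (R S) (sym (strictlyInverseˡ x)) (sym (strictlyInverseˡ y))
                        , subst₂ (R S) (strictlyInverseˡ x) (strictlyInverseˡ y)
    }

  pullback-isPrime : IsPrime S → IsPrime (pullback to S)
  pullback-isPrime S-prime P P? P-module {x} {y} {z} px py x≢y ¬pz =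
    S-prime (P ∘ from) (P? ∘ from) (P∘from-module) (back px) (back py)
            (x≢y ∘ Injection.injective (↔⇒↣ ι)) (¬pz ∘ subst P (strictlyInverseʳ z))
    where
    back : ∀ {b} → P b → P (from (to b))
    back {b} = subst P (sym (strictlyInverseʳ b))

    P∘from-module : IsModule S (P ∘ from)
    P∘from-module {z} {w} {w′} ¬pz pw pw′ =
      LookAlikeFrom-cong (strictlyInverseˡ z) (strictlyInverseˡ w) (strictlyInverseˡ w′)
        (record { LookAlikeFrom (P-module ¬pz pw pw′) })

module PrimeExtension (H : FinOPO) where
  open IsOPO (isOPO H)

  n : ℕ
  n = size H

  _<ᴴ_ _≤ᴴ_ : Fin n → Fin n → Set
  _<ᴴ_ = lt (str H)
  _≤ᴴ_ = ReflClosure _<ᴴ_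

  <-≤-trans : ∀ {a b c} → a <ᴴ b → b ≤ᴴ c → a <ᴴ c
  <-≤-trans a<b [ b<c ]   = lt-trans a<b b<c
  <-≤-trans a<b Refl.refl = a<b

  ≤-<-trans : ∀ {a b c} → a ≤ᴴ b → b <ᴴ c → a <ᴴ c
  ≤-<-trans [ a<b ]   b<c = lt-trans a<b b<c
  ≤-<-trans Refl.refl b<c = b<c

  ≤-trans : ∀ {a b c} → a ≤ᴴ b → b ≤ᴴ c → a ≤ᴴ c
  ≤-trans = ReflP.trans lt-trans

  ≤-antisym : ∀ {a b} → a ≤ᴴ b → b ≤ᴴ a → a ≡ b
  ≤-antisym = ReflP.antisym _≡_ refl (λ a<b b<a → lt-irrefl _ (lt-trans a<b b<a))

  ≤-or-> : ∀ a b → a ≤ᴴ b ⊎ b <ᴴ a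
  ≤-or-> a b with a Fin.≟ b
  ... | yes refl = inj₁ Refl.refl
  ... | no a≢b   = Sum.map₁ [_] (lt-total a b a≢b)

  R⇒≤ : ∀ {a b} → R (str H) a b → a ≤ᴴ b
  R⇒≤ {a} {b} r with a Fin.≟ b
  ... | yes refl = Refl.refl
  ... | no a≢b   = [ R⊆lt r a≢b ]

  -- Every point a of H gets a twin just above it in the linear order, and the
  -- twins form an R-chain; old points and twins are told apart by the bottom,
  -- which is R-below the twins but below no old point.
  data Point : Set where
    bottom top : Point
    old twin   : Fin n → Point

  _⊏_ : Point → Point → Set
  bottom ⊏ bottom = ⊥
  bottom ⊏ _      = ⊤
  top    ⊏ _      = ⊥
  _      ⊏ bottom = ⊥
  _      ⊏ top    = ⊤
  old a  ⊏ old b  = a <ᴴ b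
  old a  ⊏ twin b = a ≤ᴴ b
  twin a ⊏ old b  = a <ᴴ b
  twin a ⊏ twin b = a <ᴴ b

  _⊑_ : Point → Point → Set
  bottom ⊑ old _  = ⊥
  bottom ⊑ _      = ⊤
  top    ⊑ top    = ⊤
  old a  ⊑ old b  = R (str H) a b
  old a  ⊑ twin b = a ≤ᴴ b
  twin a ⊑ twin b = a ≤ᴴ b
  _      ⊑ _      = ⊥

  pointStr : Str Point
  lt pointStr = _⊏_
  R  pointStr = _⊑_

  ⊏-irrefl : ∀ x → ¬ x ⊏ x
  ⊏-irrefl (old a)  = lt-irrefl a
  ⊏-irrefl (twin a) = lt-irrefl a

  ⊏-bottom : ∀ x → ¬ x ⊏ bottom
  ⊏-bottom bottom   ()
  ⊏-bottom top      ()
  ⊏-bottom (old _)  ()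
  ⊏-bottom (twin _) ()

  ⊏-trans : ∀ {x y z} → x ⊏ y → y ⊏ z → x ⊏ z
  ⊏-trans {_}      {y}      {bottom} _ q = ⊥-elim (⊏-bottom y q)
  ⊏-trans {top}    {_}      {_}      () _
  ⊏-trans {bottom} {_}      {top}    _ _ = tt
  ⊏-trans {bottom} {_}      {old _}  _ _ = tt
  ⊏-trans {bottom} {_}      {twin _} _ _ = tt
  ⊏-trans {old _}  {_}      {top}    _ _ = tt
  ⊏-trans {twin _} {_}      {top}    _ _ = tt
  ⊏-trans {old _}  {old _}  {old _}  p q = lt-trans p q
  ⊏-trans {old _}  {old _}  {twin _} p q = [ <-≤-trans p q ]
  ⊏-trans {old _}  {twin _} {old _}  p q = ≤-<-trans p q
  ⊏-trans {old _}  {twin _} {twin _} p q = [ ≤-<-trans p q ]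
  ⊏-trans {twin _} {old _}  {old _}  p q = lt-trans p q
  ⊏-trans {twin _} {old _}  {twin _} p q = <-≤-trans p q
  ⊏-trans {twin _} {twin _} {old _}  p q = lt-trans p q
  ⊏-trans {twin _} {twin _} {twin _} p q = lt-trans p q

  ⊏-total : ∀ x y → x ≢ y → x ⊏ y ⊎ y ⊏ x
  ⊏-total bottom   bottom   x≢y = ⊥-elim (x≢y refl)
  ⊏-total bottom   top      _   = inj₁ tt
  ⊏-total bottom   (old _)  _   = inj₁ tt
  ⊏-total bottom   (twin _) _   = inj₁ tt
  ⊏-total top      bottom   _   = inj₂ tt
  ⊏-total (old _)  bottom   _   = inj₂ tt
  ⊏-total (twin _) bottom   _   = inj₂ tt
  ⊏-total top      top      x≢y = ⊥-elim (x≢y refl)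
  ⊏-total top      (old _)  _   = inj₂ tt
  ⊏-total top      (twin _) _   = inj₂ tt
  ⊏-total (old _)  top      _   = inj₁ tt
  ⊏-total (twin _) top      _   = inj₁ tt
  ⊏-total (old a)  (old b)  x≢y = lt-total a b (x≢y ∘ cong old)
  ⊏-total (old a)  (twin b) _   = ≤-or-> a b
  ⊏-total (twin a) (old b)  _   = Sum.swap (≤-or-> b a)
  ⊏-total (twin a) (twin b) x≢y = lt-total a b (x≢y ∘ cong twin)

  ⊑-refl : ∀ x → x ⊑ x
  ⊑-refl bottom   = tt
  ⊑-refl top      = tt
  ⊑-refl (old a)  = R-refl a
  ⊑-refl (twin a) = Refl.refl

  ⊑-antisym : ∀ {x y} → x ⊑ y → y ⊑ x → x ≡ y
  ⊑-antisym {bottom} {bottom} _ _ = refl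
  ⊑-antisym {top}    {top}    _ _ = refl
  ⊑-antisym {old _}  {old _}  p q = cong old (R-antisym p q)
  ⊑-antisym {twin _} {twin _} p q = cong twin (≤-antisym p q)

  ⊑-trans : ∀ {x y z} → x ⊑ y → y ⊑ z → x ⊑ z
  ⊑-trans {bottom} {bottom} {_}      _ q = q
  ⊑-trans {bottom} {top}    {top}    _ _ = tt
  ⊑-trans {bottom} {twin _} {twin _} _ _ = tt
  ⊑-trans {top}    {top}    {_}      _ q = q
  ⊑-trans {old _}  {old _}  {old _}  p q = R-trans p q
  ⊑-trans {old _}  {old _}  {twin _} p q = ≤-trans (R⇒≤ p) q
  ⊑-trans {old _}  {twin _} {twin _} p q = ≤-trans p q
  ⊑-trans {twin _} {twin _} {twin _} p q = ≤-trans p q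

  ⊑⇒⊏ : ∀ {x y} → x ⊑ y → x ≢ y → x ⊏ y
  ⊑⇒⊏ {bottom} {bottom} _ x≢y = ⊥-elim (x≢y refl)
  ⊑⇒⊏ {bottom} {top}    _ _   = tt
  ⊑⇒⊏ {bottom} {twin _} _ _   = tt
  ⊑⇒⊏ {top}    {top}    _ x≢y = ⊥-elim (x≢y refl)
  ⊑⇒⊏ {old _}  {old _}  p x≢y = R⊆lt p (x≢y ∘ cong old)
  ⊑⇒⊏ {old _}  {twin _} p _   = p
  ⊑⇒⊏ {twin _} {twin _} [ p ]     _   = p
  ⊑⇒⊏ {twin _} {twin _} Refl.refl x≢y = ⊥-elim (x≢y refl)

  pointStr-isOPO : IsOPO pointStr
  pointStr-isOPO = record
    { lt-irrefl = ⊏-irrefl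
    ; lt-trans  = λ {x} {y} {z} → ⊏-trans {x} {y} {z}
    ; lt-total  = ⊏-total
    ; R-refl    = ⊑-refl
    ; R-antisym = ⊑-antisym
    ; R-trans   = λ {x} {y} {z} → ⊑-trans {x} {y} {z}
    ; R⊆lt      = ⊑⇒⊏
    }

  module _ {P : Point → Set} (P? : Decidable P) (P-module : IsModule pointStr P) where

    all-with-bottom-and-top : P bottom → P top → ∀ {z} → ¬ ¬ P z
    all-with-bottom-and-top p⊥ p⊤ {bottom} ¬pz = ¬pz p⊥
    all-with-bottom-and-top p⊥ p⊤ {top}    ¬pz = ¬pz p⊤
    all-with-bottom-and-top p⊥ p⊤ {old _}  ¬pz = lt-into (P-module ¬pz p⊤ p⊥) tt
    all-with-bottom-and-top p⊥ p⊤ {twin _} ¬pz = lt-into (P-module ¬pz p⊤ p⊥) tt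

    only-bottom-without-top : P bottom → ¬ P top → ∀ {x} → P x → x ≡ bottom
    only-bottom-without-top p⊥ ¬p⊤ {bottom} _  = refl
    only-bottom-without-top p⊥ ¬p⊤ {top}    px = ⊥-elim (¬p⊤ px)
    only-bottom-without-top p⊥ ¬p⊤ {old _}  px = ⊥-elim (R-outof (P-module ¬p⊤ p⊥ px) tt)
    only-bottom-without-top p⊥ ¬p⊤ {twin _} px = ⊥-elim (R-outof (P-module ¬p⊤ p⊥ px) tt)

    module _ (¬p⊥ : ¬ P bottom) where

      no-old-and-twin : ∀ {a b} → P (old a) → P (twin b) → ⊥
      no-old-and-twin pa pb = R-into (P-module ¬p⊥ pb pa) tt

      no-old-and-top : ∀ {a} → P (old a) → P top → ⊥
      no-old-and-top pa p⊤ = R-into (P-module ¬p⊥ p⊤ pa) tt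

      no-twin-and-top : ∀ {a} → P (twin a) → P top → ⊥
      no-twin-and-top {a} pa p⊤ with P? (old a)
      ... | yes po = no-old-and-top po p⊤
      ... | no ¬po = R-into (P-module ¬po pa p⊤) Refl.refl

      no-two-olds : ∀ {a b} → P (old a) → P (old b) → a <ᴴ b → ⊥
      no-two-olds {a} pa pb a<b with P? (twin a)
      ... | yes pt = no-old-and-twin pa pt
      ... | no ¬pt = lt-irrefl a (lt-into (P-module ¬pt pb pa) a<b)

      no-two-twins : ∀ {a b} → P (twin a) → P (twin b) → a <ᴴ b → ⊥
      no-two-twins {b = b} pa pb a<b with P? (old b)
      ... | yes po = no-old-and-twin po pb
      ... | no ¬po = lt-irrefl b (lt-outof (P-module ¬po pa pb) a<b)

      at-most-one : ∀ {x y} → P x → P y → x ≢ y → ⊥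
      at-most-one {bottom}  {_}       px _  _   = ¬p⊥ px
      at-most-one {_}       {bottom}  _  py _   = ¬p⊥ py
      at-most-one {top}     {top}     _  _  x≢y = x≢y refl
      at-most-one {top}     {old _}   px py _   = no-old-and-top py px
      at-most-one {top}     {twin _}  px py _   = no-twin-and-top py px
      at-most-one {old _}   {top}     px py _   = no-old-and-top px py
      at-most-one {twin _}  {top}     px py _   = no-twin-and-top px py
      at-most-one {old _}   {twin _}  px py _   = no-old-and-twin px py
      at-most-one {twin _}  {old _}   px py _   = no-old-and-twin py px
      at-most-one {old a}   {old b}   px py x≢y with lt-total a b (x≢y ∘ cong old)
      ... | inj₁ a<b = no-two-olds px py a<b
      ... | inj₂ b<a = no-two-olds py px b<a
      at-most-one {twin a}  {twin b}  px py x≢y with lt-total a b (x≢y ∘ cong twin)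
      ... | inj₁ a<b = no-two-twins px py a<b
      ... | inj₂ b<a = no-two-twins py px b<a

  pointStr-isPrime : IsPrime pointStr
  pointStr-isPrime P P? P-module px py x≢y ¬pz with P? bottom | P? top
  ... | yes p⊥ | yes p⊤ = all-with-bottom-and-top P? P-module p⊥ p⊤ ¬pz
  ... | yes p⊥ | no ¬p⊤ = x≢y (trans (only-bottom-without-top P? P-module p⊥ ¬p⊤ px)
                                     (sym (only-bottom-without-top P? P-module p⊥ ¬p⊤ py)))
  ... | no ¬p⊥ | _      = at-most-one P? P-module ¬p⊥ px py x≢y

  size-Hb : ℕ
  size-Hb = suc (suc (n + n))

  toPoint : Fin size-Hb → Point
  toPoint Fin.zero             = bottom
  toPoint (Fin.suc Fin.zero)   = top
  toPoint (Fin.suc (Fin.suc i)) = Sum.[ old , twin ] (splitAt n i)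

  fromPoint : Point → Fin size-Hb
  fromPoint bottom   = Fin.zero
  fromPoint top      = Fin.suc Fin.zero
  fromPoint (old a)  = Fin.suc (Fin.suc (a ↑ˡ n))
  fromPoint (twin a) = Fin.suc (Fin.suc (n ↑ʳ a))

  toPoint-fromPoint : ∀ x → toPoint (fromPoint x) ≡ x
  toPoint-fromPoint bottom   = refl
  toPoint-fromPoint top      = refl
  toPoint-fromPoint (old a)  = cong Sum.[ old , twin ] (FinP.splitAt-↑ˡ n a n)
  toPoint-fromPoint (twin a) = cong Sum.[ old , twin ] (FinP.splitAt-↑ʳ n n a)

  fromPoint-toPoint : ∀ i → fromPoint (toPoint i) ≡ i
  fromPoint-toPoint Fin.zero              = refl
  fromPoint-toPoint (Fin.suc Fin.zero)    = refl
  fromPoint-toPoint (Fin.suc (Fin.suc i)) =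
    trans (from-split (splitAt n i)) (cong (Fin.suc ∘ Fin.suc) (FinP.join-splitAt n n i))
    where
    from-split : ∀ s → fromPoint (Sum.[ old , twin ] s) ≡ Fin.suc (Fin.suc (join n n s))
    from-split (inj₁ a) = refl
    from-split (inj₂ a) = refl

  Fin↔Point : Fin size-Hb ↔ Point
  Fin↔Point = mk↔ₛ′ toPoint fromPoint toPoint-fromPoint fromPoint-toPoint

  Hb : FinOPO
  Hb = record
    { size  = size-Hb
    ; str   = pullback toPoint pointStr
    ; isOPO = pullback-isOPO (Injection.injective (↔⇒↣ Fin↔Point)) pointStr-isOPO
    }

  Hb-bottom<top : lt (str Hb) (fromPoint bottom) (fromPoint top)
  Hb-bottom<top = tt

  Hb-isPrime : IsPrime (str Hb)
  Hb-isPrime = pullback-isPrime Fin↔Point pointStr-isPrime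

  H↪Hb : Embedding (str H) (str Hb)
  H↪Hb = Embedding-∘ (from-Embedding Fin↔Point) old-Embedding
    where
    old-injective : ∀ {a b} → old a ≡ old b → a ≡ b
    old-injective refl = refl

    old-Embedding : Embedding (str H) pointStr
    old-Embedding = record
      { map       = old
      ; injective = old-injective
      ; lt-pres   = λ _ _ → id , id
      ; R-pres    = λ _ _ → id , id
      }

prefix-suc : ∀ (x : Branch) m → prefix x (suc m) ≡ prefix x m ∷ʳ x m
prefix-suc x m = sym (ListP.applyUpTo-∷ʳ x m)

length-prefix : ∀ (x : Branch) m → length (prefix x m) ≡ m
length-prefix = ListP.length-applyUpTo

length-∷ʳ : ∀ (s : List ℕ) a → length (s ∷ʳ a) ≡ suc (length s)
length-∷ʳ s a = trans (ListP.length-++ s) (ℕP.+-comm (length s) 1)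

Agree-≤ : ∀ {k m x y} → k ≤ m → Agree m x y → Agree k x y
Agree-≤ k≤m ag j j<k = ag j (ℕP.<-≤-trans j<k k≤m)

Agree-sym : ∀ {m x y} → Agree m x y → Agree m y x
Agree-sym ag j j<m = sym (ag j j<m)

Agree-trans : ∀ {m x y z} → Agree m x y → Agree m y z → Agree m x z
Agree-trans ag ag′ j j<m = trans (ag j j<m) (ag′ j j<m)

Agree⇒prefix≡ : ∀ {x y} m → Agree m x y → prefix x m ≡ prefix y m
Agree⇒prefix≡         zero    _  = refl
Agree⇒prefix≡ {x} {y} (suc m) ag = begin
  prefix x (suc m)  ≡⟨ prefix-suc x m ⟩
  prefix x m ∷ʳ x m ≡⟨ cong₂ _∷ʳ_ (Agree⇒prefix≡ m (Agree-≤ (ℕP.n≤1+n m) ag))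
                              (ag m (ℕP.n<1+n m)) ⟩
  prefix y m ∷ʳ y m ≡⟨ prefix-suc y m ⟨
  prefix y (suc m)  ∎
  where open ≡-Reasoning

prefix≡⇒Agree : ∀ {x y} m → prefix x m ≡ prefix y m → Agree m x y
prefix≡⇒Agree         zero    _  _ ()
prefix≡⇒Agree {x} {y} (suc m) eq j j<1+m
  with ListP.∷ʳ-injective (prefix x m) (prefix y m)
         (trans (sym (prefix-suc x m)) (trans eq (prefix-suc y m)))
     | ℕP.m<1+n⇒m<n∨m≡n j<1+m
... | eq′ , _  | inj₁ j<m  = prefix≡⇒Agree m eq′ j j<m
... | _   , xm | inj₂ refl = xm

agree-or-split : ∀ m (x y : Branch) →
                 Agree m x y ⊎ Σ ℕ (λ k → k < m × Agree k x y × x k ≢ y k)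
agree-or-split zero    x y = inj₁ (λ _ ())
agree-or-split (suc m) x y with agree-or-split m x y
... | inj₂ (k , k<m , ag , xk≢yk) = inj₂ (k , ℕP.m<n⇒m<1+n k<m , ag , xk≢yk)
... | inj₁ ag with x m ℕP.≟ y m
...   | no xm≢ym = inj₂ (m , ℕP.n<1+n m , ag , xm≢ym)
...   | yes xm≡ym = inj₁ ag′
  where
  ag′ : Agree (suc m) x y
  ag′ j j<1+m with ℕP.m<1+n⇒m<n∨m≡n j<1+m
  ... | inj₁ j<m  = ag j j<m
  ... | inj₂ refl = xm≡ym

split-point-unique : ∀ {m k x y} → Agree m x y → x m ≢ y m →
                     Agree k x y → x k ≢ y k → m ≡ k
split-point-unique {m} {k} agm xm≢ym agk xk≢yk with ℕP.<-cmp m k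
... | tri< m<k _ _ = ⊥-elim (xm≢ym (agk m m<k))
... | tri≈ _ m≡k _ = m≡k
... | tri> _ _ k<m = ⊥-elim (xk≢yk (agm k k<m))

<lex-at : ∀ {k x y} → Agree k x y → x k ≢ y k → (x <lex y) ⟺ (x k < y k)
<lex-at {k} {x} {y} ag xk≢yk = at-k , λ l → k , ag , l
  where
  at-k : x <lex y → x k < y k
  at-k (m , agm , l) with split-point-unique agm (ℕP.<⇒≢ l) ag xk≢yk
  ... | refl = l

FmaxR-at : ∀ (FR : List ℕ → ℕ → ℕ → Set) {k x y} → Agree k x y → x k ≢ y k →
           FmaxR FR x y ⟺ FR (prefix x k) (x k) (y k)
FmaxR-at FR {k} {x} {y} ag xk≢yk = at-k , λ r → inj₂ (k , ag , xk≢yk , r)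
  where
  at-k : FmaxR FR x y → FR (prefix x k) (x k) (y k)
  at-k (inj₁ x≈y) = ⊥-elim (xk≢yk (x≈y k))
  at-k (inj₂ (m , agm , xm≢ym , r)) with split-point-unique agm xm≢ym ag xk≢yk
  ... | refl = r

prefix-TmaxNode : ∀ {x} → InTmax x → ∀ m → TmaxNode (prefix x m)
prefix-TmaxNode {x} x∈T =
  from 0 x (λ j → subst (x j ≤_) (sym (ℕP.+-identityʳ j)) (x∈T j))
  where
  from : ∀ k (y : Branch) → (∀ j → y j ≤ j + k) → ∀ m → nodeFrom k (prefix y m)
  from k y y≤ zero    = tt
  from k y y≤ (suc m) =
    y≤ 0 , from (suc k) (y ∘ suc)
                (λ j → subst (y (suc j) ≤_) (sym (ℕP.+-suc j k)) (y≤ (suc j))) m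

module CopyTree {FR : List ℕ → ℕ → ℕ → Set} {P : Branch → Set} {k : ℕ}
                {S : Str (Fin k)} (c : Copy FR P S) where

  e : Fin k → Branch
  e = elt c

  lt-at : ∀ {m i j} → Agree m (e i) (e j) → e i m ≢ e j m →
          lt S i j ⟺ (e i m < e j m)
  lt-at ag ne = ⟺-trans (lt-pres c _ _) (<lex-at ag ne)

  R-at : ∀ {m i j} → Agree m (e i) (e j) → e i m ≢ e j m →
         R S i j ⟺ FR (prefix (e i) m) (e i m) (e j m)
  R-at ag ne = ⟺-trans (R-pres c _ _) (FmaxR-at FR ag ne)

  -- z parts from w and w′ at node m, where w and w′ have not yet parted,
  -- and the relations between two branches are decided where they part.
  lookAlike-past-split : ∀ {m z w w′} → Agree m (e z) (e w) → e z m ≢ e w m →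
                         Agree (suc m) (e w) (e w′) → LookAlikeFrom S z w w′
  lookAlike-past-split {m} {z} {w} {w′} z~w zm≢wm w~w′ = record
    { lt-into  = proj₂ (lt-at z~w′ zm≢w′m) ∘ subst (e z m <_) wm≡w′m
               ∘ proj₁ (lt-at z~w zm≢wm)
    ; lt-outof = proj₂ (lt-at (Agree-sym z~w′) (≢-sym zm≢w′m))
               ∘ subst (_< e z m) wm≡w′m
               ∘ proj₁ (lt-at (Agree-sym z~w) (≢-sym zm≢wm))
    ; R-into   = proj₂ (R-at z~w′ zm≢w′m) ∘ subst (FR (prefix (e z) m) (e z m)) wm≡w′m
               ∘ proj₁ (R-at z~w zm≢wm)
    ; R-outof  = proj₂ (R-at (Agree-sym z~w′) (≢-sym zm≢w′m))
               ∘ subst₂ (λ t a → FR t a (e z m)) w↾m≡w′↾m wm≡w′m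
               ∘ proj₁ (R-at (Agree-sym z~w) (≢-sym zm≢wm))
    }
    where
    wm≡w′m : e w m ≡ e w′ m
    wm≡w′m = w~w′ m (ℕP.n<1+n m)

    w↾m≡w′↾m : prefix (e w) m ≡ prefix (e w′) m
    w↾m≡w′↾m = Agree⇒prefix≡ m (Agree-≤ (ℕP.n≤1+n m) w~w′)

    z~w′ : Agree m (e z) (e w′)
    z~w′ = Agree-trans z~w (Agree-≤ (ℕP.n≤1+n m) w~w′)

    zm≢w′m : e z m ≢ e w′ m
    zm≢w′m eq = zm≢wm (trans eq (sym wm≡w′m))

  Through : List ℕ → Fin k → Set
  Through s i = prefix (e i) (length s) ≡ s

  through? : ∀ s → Decidable (Through s)
  through? s i = ListP.≡-dec ℕP._≟_ (prefix (e i) (length s)) s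

  Through⇒Agree : ∀ {s i j} → Through s i → Through s j → Agree (length s) (e i) (e j)
  Through⇒Agree {s} i↓ j↓ = prefix≡⇒Agree (length s) (trans i↓ (sym j↓))

  Through-isModule : ∀ s → IsModule S (Through s)
  Through-isModule s {z} {w} {w′} ¬z↓ w↓ w′↓ with agree-or-split (length s) (e z) (e w)
  ... | inj₁ z~w = ⊥-elim (¬z↓ (trans (Agree⇒prefix≡ (length s) z~w) w↓))
  ... | inj₂ (m , m<s , z~w , zm≢wm) =
    lookAlike-past-split z~w zm≢wm (Agree-≤ m<s (Through⇒Agree w↓ w′↓))

  InT-∷ʳ : ∀ {s a} → InT e (s ∷ʳ a) →
           Σ (Fin k) (λ i → Through s i × e i (length s) ≡ a)
  InT-∷ʳ {s} {a} (i , m , s∷a≡)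
    with trans (sym (length-∷ʳ s a)) (trans (cong length s∷a≡) (length-prefix (e i) m))
  ... | refl = i , Product.map sym sym
                     (ListP.∷ʳ-injective s _ (trans s∷a≡ (prefix-suc (e i) (length s))))

  split-Splitting : ∀ {m i j} → Agree m (e i) (e j) → e i m < e j m →
                    Splitting e (prefix (e i) m)
  split-Splitting {m} {i} {j} ag l =
    e i m , e j m , ℕP.<⇒≢ l ,
    (i , suc m , sym (prefix-suc (e i) m)) ,
    (j , suc m , trans (cong (_∷ʳ e j m) (Agree⇒prefix≡ m ag)) (sym (prefix-suc (e j) m)))

  Splitting⇒branches : ∀ {s} → Splitting e s →
    Σ (Fin k) (λ i → Σ (Fin k) (λ j →
      Through s i × Through s j × e i (length s) ≢ e j (length s)))
  Splitting⇒branches (a , b , a≢b , a∈T , b∈T) with InT-∷ʳ a∈T | InT-∷ʳ b∈T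
  ... | i , i↓ , ia | j , j↓ , jb =
    i , j , i↓ , j↓ , λ eq → a≢b (trans (sym ia) (trans eq jb))

  module _ (S-isPrime : IsPrime S) where

    Splitting⇒all-Through : ∀ {s} → Splitting e s → ∀ i → Through s i
    Splitting⇒all-Through {s} sp z with through? s z
    ... | yes z↓ = z↓
    ... | no ¬z↓ with Splitting⇒branches sp
    ...   | i , j , i↓ , j↓ , i≢j =
      ⊥-elim (S-isPrime (Through s) (through? s) (Through-isModule s) i↓ j↓
                        (λ i≡j → i≢j (cong (λ i → e i (length s)) i≡j)) ¬z↓)

    Splitting-length-≤ : ∀ {s s′} → Splitting e s → Splitting e s′ →
                         length s ≤ length s′
    Splitting-length-≤ {s} {s′} sp sp′ with Splitting⇒branches sp′
    ... | i , j , _ , _ , i≢j = ℕP.≮⇒≥ λ s′<s →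
      i≢j (Through⇒Agree (s↓ i) (s↓ j) (length s′) s′<s)
      where s↓ = Splitting⇒all-Through sp

    Splitting-unique : ∀ {s s′} → Splitting e s → Splitting e s′ → s ≡ s′
    Splitting-unique {s} {s′} sp sp′ with Splitting⇒branches sp
    ... | i , _ = begin
      s                        ≡⟨ Splitting⇒all-Through sp i ⟨
      prefix (e i) (length s)  ≡⟨ cong (prefix (e i)) length-s≡length-s′ ⟩
      prefix (e i) (length s′) ≡⟨ Splitting⇒all-Through sp′ i ⟩
      s′                       ∎
      where
      open ≡-Reasoning
      length-s≡length-s′ : length s ≡ length s′
      length-s≡length-s′ =
        ℕP.≤-antisym (Splitting-length-≤ sp sp′) (Splitting-length-≤ sp′ sp)

    module Stem (S-isOPO : IsOPO S) (i₀ j₀ : Fin k) (i₀<j₀ : lt S i₀ j₀)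
                (e-InTmax : ∀ i → InTmax (e i))
                (FR-refl : ∀ t → TmaxNode t → (a : Fin (suc (length t))) →
                           FR t (toℕ a) (toℕ a))
                where
      open IsOPO S-isOPO using (lt-irrefl; lt-total; R-refl)

      first-split : e i₀ <lex e j₀
      first-split = proj₁ (lt-pres c i₀ j₀) i₀<j₀

      stem : List ℕ
      stem = prefix (e i₀) (proj₁ first-split)

      stem-Splitting : Splitting e stem
      stem-Splitting = let _ , ag , l = first-split in split-Splitting ag l

      stem-all : ∀ i → Through stem i
      stem-all = Splitting⇒all-Through stem-Splitting

      ℓ : ℕ
      ℓ = length stem

      <lex⇒<-at-stem : ∀ {i j} → e i <lex e j → e i ℓ < e j ℓ
      <lex⇒<-at-stem {i} {j} (m , ag , l) = subst (λ m → e i m < e j m) m≡ℓ l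
        where
        m≡ℓ : m ≡ ℓ
        m≡ℓ = trans (sym (length-prefix (e i) m))
                    (cong length (Splitting-unique (split-Splitting ag l) stem-Splitting))

      differ-at-stem : ∀ {i j} → i ≢ j → e i ℓ ≢ e j ℓ
      differ-at-stem {i} {j} i≢j with lt-total i j i≢j
      ... | inj₁ i<j = ℕP.<⇒≢ (<lex⇒<-at-stem (proj₁ (lt-pres c i j) i<j))
      ... | inj₂ j<i = ≢-sym (ℕP.<⇒≢ (<lex⇒<-at-stem (proj₁ (lt-pres c j i) j<i)))

      successor : Fin k → Fin (suc ℓ)
      successor i = fromℕ< (s≤s (e-InTmax i ℓ))

      toℕ-successor : ∀ i → toℕ (successor i) ≡ e i ℓ
      toℕ-successor i = FinP.toℕ-fromℕ< _

      successor-InT : ∀ i → InT e (stem ∷ʳ toℕ (successor i))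
      successor-InT i = i , suc ℓ ,
        trans (cong₂ _∷ʳ_ (sym (stem-all i)) (toℕ-successor i)) (sym (prefix-suc (e i) ℓ))

      InT-successor : ∀ a → InT e (stem ∷ʳ toℕ a) →
                      Σ (Fin k) (λ i → successor i ≡ a)
      InT-successor a a∈T with InT-∷ʳ a∈T
      ... | i , _ , ia = i , FinP.toℕ-injective (trans (toℕ-successor i) ia)

      successor-injective : ∀ i j → successor i ≡ successor j → i ≡ j
      successor-injective i j eq with i Fin.≟ j
      ... | yes i≡j = i≡j
      ... | no i≢j  = ⊥-elim (differ-at-stem i≢j (begin
        e i ℓ              ≡⟨ toℕ-successor i ⟨
        toℕ (successor i)  ≡⟨ cong toℕ eq ⟩
        toℕ (successor j)  ≡⟨ toℕ-successor j ⟩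
        e j ℓ              ∎))
        where open ≡-Reasoning

      successor-lt : ∀ i j → lt S i j ⟺ (successor i Fin.< successor j)
      successor-lt i j with i Fin.≟ j
      ... | yes refl = (λ l → ⊥-elim (lt-irrefl i l)) , (λ l → ⊥-elim (ℕP.<-irrefl refl l))
      ... | no i≢j   =
        subst₂ (λ a b → lt S i j ⟺ (a < b)) (sym (toℕ-successor i)) (sym (toℕ-successor j))
               (lt-at (Through⇒Agree (stem-all i) (stem-all j)) (differ-at-stem i≢j))

      successor-R : ∀ i j → R S i j ⟺ FR stem (toℕ (successor i)) (toℕ (successor j))
      successor-R i j with i Fin.≟ j
      ... | yes refl = (λ _ → FR-refl stem (prefix-TmaxNode (e-InTmax i₀) _) (successor i))
                     , (λ _ → R-refl i)
      ... | no i≢j   =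
        subst₂ (λ a b → R S i j ⟺ FR stem a b) (sym (toℕ-successor i)) (sym (toℕ-successor j))
               (subst (λ t → R S i j ⟺ FR t (e i ℓ) (e j ℓ)) (stem-all i)
                      (R-at (Through⇒Agree (stem-all i) (stem-all j)) (differ-at-stem i≢j)))

      oneSplit : OneSplit FR S e
      oneSplit = stem , stem-Splitting , (λ _ sp → Splitting-unique sp stem-Splitting) ,
                 successor , successor-InT , InT-successor , successor-injective ,
                 successor-lt , successor-R

lemma6p7 : (L : Str ℕ) → IsFraisseLimit L →
           (FR : List ℕ → ℕ → ℕ → Set) →
           (∀ t → TmaxNode t → Iso (Fstr FR t) (L ↾ length t)) →
           (H : FinOPO) →
           Σ FinOPO (λ Hb → Embedding (str H) (str Hb) ×
             ((G : Branch → Set) → IsUILS FR G →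
              (c : Copy FR G (str Hb)) → OneSplit FR (str Hb) (elt c)))
lemma6p7 L L-isFraisseLimit FR F≅L H = Hb , H↪Hb , λ G G-isUILS c →
  CopyTree.Stem.oneSplit c Hb-isPrime (isOPO Hb) (fromPoint bottom) (fromPoint top) Hb-bottom<top
    (λ i → IsUILS.⊆Tmax G-isUILS _ (inP c i)) FR-refl
  where
  open PrimeExtension H using (Hb; H↪Hb; Hb-isPrime; fromPoint; bottom; top; Hb-bottom<top)

  FR-refl : ∀ t → TmaxNode t → (a : Fin (suc (length t))) → FR t (toℕ a) (toℕ a)
  FR-refl t t∈T = Embedding-R-refl (emb (F≅L t t∈T))
                    (λ i → IsOPO.R-refl (IsFraisseLimit.isOPO L-isFraisseLimit) (toℕ i))
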